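{- Let $g\ge4$ be even. (1) Let $m\neq g-1$ be a primitive number, let $n=o_g(m)$, and let $x_0$ be a point of an extreme cycle $x_0,x_1,\dots,x_{n-1}$ for $\{0,m\}$ with digits $l_0,\dots,l_{n-1}\in\{0,m\}$, i.e. $x_{j+1}=(x_j+l_j)/g$ (indices modulo $n$). Put $k_i=l_i/m\in\{0,1\}$ and $d=\gcd\big(k_0+gk_1+\dots+g^{n-1}k_{n-1},\,g^n-1\big)$. Then $m=\frac{g^n-1}{d}$. (2) Conversely, let $n\ge1$ and let $k_0,\dots,k_{n-1}\in\{0,1\}$, not all zero; put $d=\gcd\big(k_0+gk_1+\dots+g^{n-1}k_{n-1},\,g^n-1\big)$ and $m=\frac{g^n-1}{d}$. Then $m$ is incomplete, and there is an extreme cycle for $\{0,m\}$ with digits $mk_0,mk_1,\dots,mk_{n-1}$, i.e. there are integers $x_0,\dots,x_{n-1}$, not all zero, with $x_{j+1}=(x_j+mk_j)/g$ for all $j$ (indices modulo $n$).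
   Context: For an odd integer $m\ge1$, an extreme cycle for the digit set $\{0,m\}$ (with respect to the even integer $g\ge4$) is a finite set of distinct integers $\{x_0,\dots,x_{r-1}\}$ together with digits $l_0,\dots,l_{r-1}\in\{0,m\}$ such that $x_{j+1}=(x_j+l_j)/g$ for $0\le j\le r-2$ and $x_0=(x_{r-1}+l_{r-1})/g$. The cycle $\{0\}$ is the trivial extreme cycle. $m$ is complete if the only extreme cycle for $\{0,m\}$ is the trivial one, and incomplete otherwise. An odd number $m$ is primitive if it is incomplete and every proper divisor of $m$ is complete. Primitive numbers are coprime to $g$, and $o_g(m)$ denotes the order of $g$ in $U(\mathbb{Z}_m)$; for a primitive $m$ every extreme cycle has exactly $o_g(m)$ elements. -}

module Defs where

open import Data.Nat using (ℕ; zero; suc; _+_; _*_; _∸_; _^_; _≤_; _<_)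
open import Data.Nat.Divisibility using (_∣_)
open import Data.Nat.DivMod using (_%_; m%n<n)
open import Data.Integer as ℤ using (ℤ; +_)
open import Data.Fin using (Fin; toℕ; fromℕ<) renaming (zero to Fzero; suc to Fsuc)
open import Data.Product using (_×_)
open import Data.Sum using (_⊎_)
open import Function.Definitions using (Injective)
open import Relation.Binary.PropositionalEquality using (_≡_; _≢_)
open import Relation.Nullary using (¬_)

Even : ℕ → Set
Even n = 2 ∣ n

Odd : ℕ → Set
Odd n = ¬ (2 ∣ n)

next : {n : ℕ} → Fin n → Fin n
next {suc n} i = fromℕ< (m%n<n (suc (toℕ i)) (suc n))

∑ : (n : ℕ) → (Fin n → ℕ) → ℕ
∑ zero    f = 0
∑ (suc n) f = f Fzero + ∑ n (λ i → f (Fsuc i))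

digitSum : (g n : ℕ) → (Fin n → ℕ) → ℕ
digitSum g n k = ∑ n (λ i → g ^ toℕ i * k i)

IsExtremeCycle : (g m r : ℕ) → (Fin r → ℤ) → (Fin r → ℤ) → Set
IsExtremeCycle g m r x l =
  (1 ≤ r)
  × Injective _≡_ _≡_ x
  × (∀ j → l j ≡ + 0 ⊎ l j ≡ + m)
  × (∀ j → + g ℤ.* x (next j) ≡ x j ℤ.+ l j)

Complete : (g m : ℕ) → Set
Complete g m = ∀ r x l → IsExtremeCycle g m r x l → ∀ j → x j ≡ + 0

Incomplete : (g m : ℕ) → Set
Incomplete g m = ¬ Complete g m

Primitive : (g m : ℕ) → Set
Primitive g m = Odd m × Incomplete g m × (∀ e → e ∣ m → e ≢ m → Complete g e)

IsOrder : (g m n : ℕ) → Set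
IsOrder g m n = (1 ≤ n) × (m ∣ g ^ n ∸ 1) × (∀ k → 1 ≤ k → m ∣ g ^ k ∸ 1 → n ≤ k)

-- Along an extreme cycle x with digits m k_j, running once around the cycle gives
-- (g^n - 1) x_t = m R_t, where R_t is the base-g value of the digit string read from position t;
-- so all points are nonnegative and g^n - 1 divides m R_0 = m (k_0 + g k_1 + ... + g^(n-1) k_(n-1)),
-- whence (g^n - 1)/d divides m. Conversely, for any 0/1 digit string, d is prime to g and divides
-- every R_t, and the numbers R_t / d form an orbit for the digit set {0, (g^n - 1)/d}; the orbit up to
-- its first return is a nontrivial extreme cycle, so (g^n - 1)/d is incomplete. For primitive m this
-- incomplete divisor must be m itself.
module Submission where

open import Defs
open import Data.Nat using (ℕ; zero; suc; _+_; _*_; _∸_; _^_; _≤_; _<_; z≤n; s≤s; z<s; _≟_; NonZero; ≢-nonZero; >-nonZero; ≢-nonZero⁻¹)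
open import Data.Nat.Properties
open import Data.Nat.Divisibility using (_∣_; divides; ∣m+n∣m⇒∣n; ∣m∣n⇒∣m+n; ∣m⇒∣m*n; ∣-refl; ∣-trans; ∣1⇒≡1; ∣⇒≤; *-cancelʳ-∣)
open import Data.Nat.GCD using (gcd; gcd[m,n]∣m; gcd[m,n]∣n; gcd[m,n]≢0)
open import Data.Nat.Coprimality as Coprimality using (Coprime; coprime-divisor; coprime-/gcd)
open import Data.Nat.DivMod using (_/_; m/n*n≡m; _%_; m%n<n; m<n⇒m%n≡m; [m+n]%n≡m%n; %-distribˡ-+; m%n%n≡m%n; n%n≡0)
open import Data.Nat.Tactic.RingSolver using (solve-∀)
open import Data.Fin using (Fin; toℕ; fromℕ<) renaming (zero to Fzero; suc to Fsuc)
open import Data.Fin.Properties using (toℕ-injective; toℕ-fromℕ<; toℕ<n) renaming (0≢1+n to Fzero≢Fsuc)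
open import Data.Product using (_×_; Σ; _,_; ∃-syntax; proj₁; proj₂)
open import Data.Sum using (_⊎_; inj₁; inj₂)
open import Data.Integer as ℤ using (ℤ; +_; -[1+_])
import Data.Integer.Properties as ℤ
import Data.Integer.Tactic.RingSolver as ℤ-Solver
open import Data.Empty using (⊥-elim)
open import Relation.Binary.PropositionalEquality
open import Relation.Nullary using (yes; no; ¬_)
open import Relation.Unary using (Decidable)
open import Relation.Binary.Definitions using (tri<; tri≈; tri>)
open import Function.Definitions using (Injective)

-- Base-g values of digit strings

sumUpTo : ℕ → (ℕ → ℕ) → ℕ
sumUpTo zero    f = 0
sumUpTo (suc s) f = sumUpTo s f + f s

sumUpTo-cong : ∀ s {f h : ℕ → ℕ} → (∀ i → f i ≡ h i) → sumUpTo s f ≡ sumUpTo s h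
sumUpTo-cong zero    f≗h = refl
sumUpTo-cong (suc s) f≗h = cong₂ _+_ (sumUpTo-cong s f≗h) (f≗h s)

sumUpTo-head : ∀ s f → sumUpTo (suc s) f ≡ f 0 + sumUpTo s (λ i → f (suc i))
sumUpTo-head zero    f = +-comm 0 (f 0)
sumUpTo-head (suc s) f rewrite sumUpTo-head s f = +-assoc (f 0) _ _

∑-cong : ∀ n {f h : Fin n → ℕ} → (∀ i → f i ≡ h i) → ∑ n f ≡ ∑ n h
∑-cong zero    f≗h = refl
∑-cong (suc n) f≗h = cong₂ _+_ (f≗h Fzero) (∑-cong n (λ i → f≗h (Fsuc i)))

∑-toℕ : ∀ n f → ∑ n (λ i → f (toℕ i)) ≡ sumUpTo n f
∑-toℕ zero    f = refl
∑-toℕ (suc n) f rewrite ∑-toℕ n (λ i → f (suc i)) = sym (sumUpTo-head n f)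

∑≡0⇒zeros : ∀ n (f : Fin n → ℕ) → ∑ n f ≡ 0 → ∀ i → f i ≡ 0
∑≡0⇒zeros (suc n) f eq Fzero    = m+n≡0⇒m≡0 (f Fzero) eq
∑≡0⇒zeros (suc n) f eq (Fsuc i) = ∑≡0⇒zeros n (λ j → f (Fsuc j)) (m+n≡0⇒n≡0 (f Fzero) eq) i

baseValue : ℕ → ℕ → (ℕ → ℕ) → ℕ
baseValue g s F = sumUpTo s (λ i → g ^ i * F i)

baseValue-cong : ∀ g s {F H : ℕ → ℕ} → (∀ i → F i ≡ H i) → baseValue g s F ≡ baseValue g s H
baseValue-cong g s F≗H = sumUpTo-cong s (λ i → cong (g ^ i *_) (F≗H i))

baseValue-shift : ∀ g s F → g * baseValue g s (λ i → F (suc i)) + F 0 ≡ baseValue g s F + g ^ s * F s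
baseValue-shift g zero    F = rearrange g (F 0)
  where
  rearrange : ∀ g x → g * 0 + x ≡ 0 + 1 * x
  rearrange = solve-∀
baseValue-shift g (suc s) F = begin
  g * (V′ + g ^ s * F (suc s)) + F 0        ≡⟨ rearrange g V′ (g ^ s) (F (suc s)) (F 0) ⟩
  (g * V′ + F 0) + g * g ^ s * F (suc s)    ≡⟨ cong (_+ g * g ^ s * F (suc s)) (baseValue-shift g s F) ⟩
  baseValue g s F + g ^ s * F s + g * g ^ s * F (suc s) ∎
  where
  open ≡-Reasoning
  V′ : ℕ
  V′ = baseValue g s (λ i → F (suc i))
  rearrange : ∀ g v p x y → g * (v + p * x) + y ≡ (g * v + y) + g * p * x
  rearrange = solve-∀

baseValue-bits-bound : ∀ g s F → (∀ i → F i ≤ 1) → g * baseValue (suc g) s F + 1 ≤ suc g ^ s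
baseValue-bits-bound g zero    F bits = ≤-reflexive (cong (_+ 1) (*-zeroʳ g))
baseValue-bits-bound g (suc s) F bits = begin
  g * (V + suc g ^ s * F s) + 1        ≡⟨ rearrange g V (suc g ^ s) (F s) ⟩
  (g * V + 1) + g * (suc g ^ s * F s)  ≤⟨ +-mono-≤ (baseValue-bits-bound g s F bits) (*-monoʳ-≤ g top-digit) ⟩
  suc g ^ s + g * suc g ^ s            ∎
  where
  open ≤-Reasoning
  V : ℕ
  V = baseValue (suc g) s F
  top-digit : suc g ^ s * F s ≤ suc g ^ s
  top-digit = ≤-trans (*-monoʳ-≤ (suc g ^ s) (bits s)) (≤-reflexive (*-identityʳ _))
  rearrange : ∀ g v p x → g * (v + p * x) + 1 ≡ (g * v + 1) + g * (p * x)
  rearrange = solve-∀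

digitSum≡0⇒zeros : ∀ g .{{_ : NonZero g}} n (k : Fin n → ℕ) → digitSum g n k ≡ 0 → ∀ i → k i ≡ 0
digitSum≡0⇒zeros g n k eq i with m*n≡0⇒m≡0∨n≡0 (g ^ toℕ i) (∑≡0⇒zeros n _ eq i)
... | inj₁ g^i≡0 = ⊥-elim (≢-nonZero⁻¹ g (m^n≡0⇒m≡0 g (toℕ i) g^i≡0))
... | inj₂ ki≡0  = ki≡0

-- Indices modulo n and rotated digit strings

wrap : ∀ {n} → ℕ → Fin (suc n)
wrap {n} t = fromℕ< (m%n<n t (suc n))

wrap-toℕ : ∀ {n} (j : Fin (suc n)) → wrap (toℕ j) ≡ j
wrap-toℕ j = toℕ-injective (trans (toℕ-fromℕ< _) (m<n⇒m%n≡m (toℕ<n j)))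

wrap-periodic : ∀ {n} t → wrap {n} (t + suc n) ≡ wrap t
wrap-periodic {n} t = toℕ-injective (trans (toℕ-fromℕ< _) (trans ([m+n]%n≡m%n t (suc n)) (sym (toℕ-fromℕ< _))))

next-wrap : ∀ {n} t → next (wrap {n} t) ≡ wrap (suc t)
next-wrap {n} t = toℕ-injective (begin
  toℕ (next (wrap t))                   ≡⟨ toℕ-fromℕ< _ ⟩
  suc (toℕ (wrap {n} t)) % suc n        ≡⟨ cong (λ v → suc v % suc n) (toℕ-fromℕ< _) ⟩
  (1 + t % suc n) % suc n               ≡⟨ %-distribˡ-+ 1 (t % suc n) (suc n) ⟩
  (1 % suc n + t % suc n % suc n) % suc n ≡⟨ cong (λ v → (1 % suc n + v) % suc n) (m%n%n≡m%n t (suc n)) ⟩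
  (1 % suc n + t % suc n) % suc n       ≡⟨ %-distribˡ-+ 1 t (suc n) ⟨
  suc t % suc n                         ≡⟨ toℕ-fromℕ< _ ⟨
  toℕ (wrap {n} (suc t))                ∎)
  where open ≡-Reasoning

toℕ-next-closed : ∀ {ℓ} {B : Set ℓ} {p} (A : ℕ → B) → A (suc p) ≡ A 0 →
                  ∀ (j : Fin (suc p)) → A (toℕ (next j)) ≡ A (suc (toℕ j))
toℕ-next-closed {p = p} A closed j with suc (toℕ j) <? suc p
... | yes lt = cong A (trans (toℕ-fromℕ< _) (m<n⇒m%n≡m lt))
... | no ¬lt = begin
  A (toℕ (next j))  ≡⟨ cong A (trans (toℕ-fromℕ< _) (trans (cong (_% suc p) last) (n%n≡0 (suc p)))) ⟩
  A 0               ≡⟨ closed ⟨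
  A (suc p)         ≡⟨ cong A last ⟨
  A (suc (toℕ j))   ∎
  where
  open ≡-Reasoning
  last : suc (toℕ j) ≡ suc p
  last = ≤-antisym (toℕ<n j) (≮⇒≥ ¬lt)

rotatedValue : ∀ {n} → ℕ → (Fin (suc n) → ℕ) → ℕ → ℕ
rotatedValue {n} g k t = baseValue g (suc n) (λ i → k (wrap (t + i)))

rotatedValue-0 : ∀ g {n} (k : Fin (suc n) → ℕ) → rotatedValue g k 0 ≡ digitSum g (suc n) k
rotatedValue-0 g {n} k = sym (begin
  ∑ (suc n) (λ i → g ^ toℕ i * k i)                   ≡⟨ ∑-cong (suc n) (λ i → cong (λ j → g ^ toℕ i * k j) (wrap-toℕ i)) ⟨
  ∑ (suc n) (λ i → g ^ toℕ i * k (wrap (toℕ i)))      ≡⟨ ∑-toℕ (suc n) (λ i → g ^ i * k (wrap i)) ⟩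
  rotatedValue g k 0                                  ∎)
  where open ≡-Reasoning

rotatedValue-periodic : ∀ g {n} (k : Fin (suc n) → ℕ) → rotatedValue g k (suc n) ≡ rotatedValue g k 0
rotatedValue-periodic g {n} k = baseValue-cong g (suc n) (λ i → cong k (trans (cong wrap (+-comm (suc n) i)) (wrap-periodic i)))

rotatedValue-step : ∀ g {n} (k : Fin (suc n) → ℕ) t →
                    g * rotatedValue g k (suc t) + k (wrap t) ≡ rotatedValue g k t + g ^ suc n * k (wrap t)
rotatedValue-step g {n} k t = begin
  g * rotatedValue g k (suc t) + k (wrap t)           ≡⟨ cong₂ (λ u v → g * u + k (wrap v)) shifted (+-identityʳ t) ⟨
  g * baseValue g (suc n) (λ i → F (suc i)) + F 0     ≡⟨ baseValue-shift g (suc n) F ⟩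
  rotatedValue g k t + g ^ suc n * F (suc n)          ≡⟨ cong (λ v → rotatedValue g k t + g ^ suc n * k v) (wrap-periodic t) ⟩
  rotatedValue g k t + g ^ suc n * k (wrap t)         ∎
  where
  open ≡-Reasoning
  F : ℕ → ℕ
  F i = k (wrap (t + i))
  shifted : baseValue g (suc n) (λ i → F (suc i)) ≡ rotatedValue g k (suc t)
  shifted = baseValue-cong g (suc n) (λ i → cong (λ v → k (wrap v)) (+-suc t i))

-- Divisibility and g ^ n - 1

pow∸1≢0 : ∀ {g} → 1 < g → ∀ n → g ^ suc n ∸ 1 ≢ 0
pow∸1≢0 {g} 1<g n = m>n⇒m∸n≢0 (^-monoʳ-< g 1<g {0} {suc n} (s≤s z≤n))

coprime-pow∸1 : ∀ g .{{_ : NonZero g}} n → Coprime g (g ^ suc n ∸ 1)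
coprime-pow∸1 g n {c} (c∣g , c∣N) = ∣1⇒≡1 (∣m+n∣m⇒∣n c∣g^[1+n] c∣N)
  where
  c∣g^[1+n] : c ∣ (g ^ suc n ∸ 1) + 1
  c∣g^[1+n] = subst (c ∣_) (sym (m∸n+n≡m (m^n>0 g (suc n)))) (∣m⇒∣m*n (g ^ n) c∣g)

∣-along-orbit : ∀ {g d} {S E : ℕ → ℕ} → Coprime d g → d ∣ S 0 →
                (∀ t → g * S (suc t) ≡ S t + d * E t) → ∀ t → d ∣ S t
∣-along-orbit coprime d∣S₀ step zero    = d∣S₀
∣-along-orbit {d = d} {E = E} coprime d∣S₀ step (suc t) =
  coprime-divisor coprime (subst (d ∣_) (sym (step t)) (∣m∣n⇒∣m+n (∣-along-orbit coprime d∣S₀ step t) (∣m⇒∣m*n (E t) ∣-refl)))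

∣m*s⇒N/gcd∣m : ∀ {m s N} .{{_ : NonZero (gcd s N)}} → N ∣ m * s → N / gcd s N ∣ m
∣m*s⇒N/gcd∣m {m} {s} {N} N∣ms = coprime-divisor (Coprimality.sym (coprime-/gcd s N)) (*-cancelʳ-∣ d (subst₂ _∣_ (sym N′d≡N) (sym s′md≡ms) N∣ms))
  where
  d : ℕ
  d = gcd s N
  N′d≡N : N / d * d ≡ N
  N′d≡N = m/n*n≡m (gcd[m,n]∣n s N)
  s′md≡ms : s / d * m * d ≡ m * s
  s′md≡ms = begin
    s / d * m * d     ≡⟨ *-assoc (s / d) m d ⟩
    s / d * (m * d)   ≡⟨ cong (s / d *_) (*-comm m d) ⟩
    s / d * (d * m)   ≡⟨ *-assoc (s / d) d m ⟨
    s / d * d * m     ≡⟨ cong (_* m) (m/n*n≡m (gcd[m,n]∣m s N)) ⟩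
    s * m             ≡⟨ *-comm s m ⟩
    m * s             ∎
    where open ≡-Reasoning

m*S≡N*a⇒a≡0 : ∀ {m c S N a} → m < c → 0 < N → c * S ≤ N → m * S ≡ N * a → a ≡ 0
m*S≡N*a⇒a≡0 {a = zero} _ _ _ _ = refl
m*S≡N*a⇒a≡0 {m} {S = zero} {N} {suc a} _ 0<N _ eq =
  ⊥-elim (<-irrefl (trans (sym (*-zeroʳ m)) eq) (<-≤-trans 0<N (m≤m*n N (suc a))))
m*S≡N*a⇒a≡0 {S = suc s} {N} {suc a} m<c _ cS≤N eq =
  ⊥-elim (<-irrefl eq (<-≤-trans (*-monoˡ-< (suc s) m<c) (≤-trans cS≤N (m≤m*n N (suc a)))))

-- Cycles in ℤ

telescope : ∀ g m (X : ℕ → ℤ) (K : ℕ → ℕ) → (∀ t → + g ℤ.* X (suc t) ≡ X t ℤ.+ + (m * K t)) →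
            ∀ s t → X t ℤ.+ + (m * baseValue g s (λ i → K (t + i))) ≡ + (g ^ s) ℤ.* X (t + s)
telescope g m X K step zero t = begin
  X t ℤ.+ + (m * 0)  ≡⟨ cong (λ v → X t ℤ.+ + v) (*-zeroʳ m) ⟩
  X t ℤ.+ + 0        ≡⟨ ℤ.+-identityʳ (X t) ⟩
  X t                ≡⟨ ℤ.*-identityˡ (X t) ⟨
  + 1 ℤ.* X t        ≡⟨ cong (λ v → + 1 ℤ.* X v) (+-identityʳ t) ⟨
  + 1 ℤ.* X (t + 0)  ∎
  where open ≡-Reasoning
telescope g m X K step (suc s) t = begin
  X t ℤ.+ + (m * (V + p * κ))                      ≡⟨ cong (λ v → X t ℤ.+ v) (pos-*-+ m V p κ) ⟩
  X t ℤ.+ + m ℤ.* (+ V ℤ.+ + p ℤ.* + κ)            ≡⟨ expand (X t) (+ m) (+ V) (+ p) (+ κ) ⟩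
  (X t ℤ.+ + m ℤ.* + V) ℤ.+ + p ℤ.* (+ m ℤ.* + κ)  ≡⟨ cong₂ (λ u v → u ℤ.+ + p ℤ.* v) lower (ℤ.pos-* m κ) ⟨
  + p ℤ.* X (t + s) ℤ.+ + p ℤ.* + (m * κ)          ≡⟨ ℤ.*-distribˡ-+ (+ p) (X (t + s)) _ ⟨
  + p ℤ.* (X (t + s) ℤ.+ + (m * κ))                ≡⟨ cong (λ v → + p ℤ.* v) (step (t + s)) ⟨
  + p ℤ.* (+ g ℤ.* X (suc (t + s)))                ≡⟨ swap (+ p) (+ g) (X (suc (t + s))) ⟩
  (+ g ℤ.* + p) ℤ.* X (suc (t + s))                ≡⟨ cong₂ ℤ._*_ (ℤ.pos-* g p) (cong X (+-suc t s)) ⟨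
  + (g * p) ℤ.* X (t + suc s)                      ∎
  where
  open ≡-Reasoning
  V : ℕ
  V = baseValue g s (λ i → K (t + i))
  p : ℕ
  p = g ^ s
  κ : ℕ
  κ = K (t + s)
  pos-*-+ : ∀ m a b c → + (m * (a + b * c)) ≡ + m ℤ.* (+ a ℤ.+ + b ℤ.* + c)
  pos-*-+ m a b c = trans (ℤ.pos-* m _) (cong (λ v → + m ℤ.* v) (trans (ℤ.pos-+ a _) (cong (λ v → + a ℤ.+ v) (ℤ.pos-* b c))))
  lower : + p ℤ.* X (t + s) ≡ X t ℤ.+ + m ℤ.* + V
  lower = trans (sym (telescope g m X K step s t)) (cong (λ v → X t ℤ.+ v) (ℤ.pos-* m V))
  expand : ∀ x m v p c → x ℤ.+ m ℤ.* (v ℤ.+ p ℤ.* c) ≡ (x ℤ.+ m ℤ.* v) ℤ.+ p ℤ.* (m ℤ.* c)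
  expand = ℤ-Solver.solve-∀
  swap : ∀ p g y → p ℤ.* (g ℤ.* y) ≡ (g ℤ.* p) ℤ.* y
  swap = ℤ-Solver.solve-∀

nonneg-solution : ∀ N c (x : ℤ) → x ℤ.+ + c ≡ + suc (suc N) ℤ.* x → ∃[ a ] x ≡ + a × c ≡ suc N * a
nonneg-solution N c (+ a) eq = a , refl , +-cancelˡ-≡ a c (suc N * a) (ℤ.+-injective (begin
  + (a + c)                ≡⟨ ℤ.pos-+ a c ⟩
  + a ℤ.+ + c              ≡⟨ eq ⟩
  + suc (suc N) ℤ.* + a    ≡⟨ ℤ.pos-* (suc (suc N)) a ⟨
  + (suc (suc N) * a)      ∎))
  where open ≡-Reasoning
nonneg-solution N c -[1+ u ] eq = ⊥-elim (<-irrefl (sym (ℤ.+-injective absurd-equation)) too-big)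
  where
  G : ℕ
  G = suc (suc N)
  too-big : suc u < c + G * suc u
  too-big = <-≤-trans (<-≤-trans (m<m*n (suc u) G (s≤s (s≤s z≤n))) (≤-reflexive (*-comm (suc u) G))) (m≤n+m (G * suc u) c)
  move : ∀ c G y → c ℤ.+ G ℤ.* y ≡ (ℤ.- y ℤ.+ c) ℤ.+ (y ℤ.+ G ℤ.* y)
  move = ℤ-Solver.solve-∀
  cancel : ∀ G y → G ℤ.* ℤ.- y ℤ.+ (y ℤ.+ G ℤ.* y) ≡ y
  cancel = ℤ-Solver.solve-∀
  absurd-equation : + (c + G * suc u) ≡ + suc u
  absurd-equation = begin
    + (c + G * suc u)                                   ≡⟨ trans (ℤ.pos-+ c _) (cong (λ v → + c ℤ.+ v) (ℤ.pos-* G (suc u))) ⟩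
    + c ℤ.+ + G ℤ.* + suc u                             ≡⟨ move (+ c) (+ G) (+ suc u) ⟩
    (-[1+ u ] ℤ.+ + c) ℤ.+ (+ suc u ℤ.+ + G ℤ.* + suc u) ≡⟨ cong (λ v → v ℤ.+ (+ suc u ℤ.+ + G ℤ.* + suc u)) eq ⟩
    + G ℤ.* -[1+ u ] ℤ.+ (+ suc u ℤ.+ + G ℤ.* + suc u)   ≡⟨ cancel (+ G) (+ suc u) ⟩
    + suc u                                             ∎
    where open ≡-Reasoning

cycle-value : ∀ {g m n} → 1 < g → (x : Fin (suc n) → ℤ) (k : Fin (suc n) → ℕ) →
              (∀ j → + g ℤ.* x (next j) ≡ x j ℤ.+ + (m * k j)) →
              ∀ t → ∃[ a ] x (wrap t) ≡ + a × m * rotatedValue g k t ≡ (g ^ suc n ∸ 1) * a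
cycle-value {g} {m} {n} 1<g x k step t =
  rename-N (nonneg-solution (G ∸ 2) (m * rotatedValue g k t) (x (wrap t)) returns)
  where
  G : ℕ
  G = g ^ suc n
  G≡2+G∸2 : G ≡ suc (suc (G ∸ 2))
  G≡2+G∸2 = sym (m+[n∸m]≡n (^-monoʳ-< g 1<g {0} {suc n} (s≤s z≤n)))
  step-wrapped : ∀ t → + g ℤ.* x (wrap (suc t)) ≡ x (wrap t) ℤ.+ + (m * k (wrap t))
  step-wrapped t = trans (cong (λ v → + g ℤ.* x v) (sym (next-wrap t))) (step (wrap t))
  returns : x (wrap t) ℤ.+ + (m * rotatedValue g k t) ≡ + suc (suc (G ∸ 2)) ℤ.* x (wrap t)
  returns = trans (telescope g m (λ t → x (wrap t)) (λ t → k (wrap t)) step-wrapped (suc n) t)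
                  (cong₂ ℤ._*_ (cong +_ G≡2+G∸2) (cong x (wrap-periodic t)))
  rename-N : ∀ {c y} → ∃[ a ] y ≡ + a × c ≡ suc (G ∸ 2) * a → ∃[ a ] y ≡ + a × c ≡ (G ∸ 1) * a
  rename-N (a , y≡a , c≡Na) = a , y≡a , trans c≡Na (cong (_* a) (sym (cong (_∸ 1) G≡2+G∸2)))

digit-bit : ∀ {m} {z : ℤ} → z ≡ + 0 ⊎ z ≡ + m → ∃[ b ] b ≤ 1 × z ≡ + (m * b)
digit-bit {m} (inj₁ z≡0) = 0 , z≤n , trans z≡0 (cong +_ (sym (*-zeroʳ m)))
digit-bit {m} (inj₂ z≡m) = 1 , s≤s z≤n , trans z≡m (cong +_ (sym (*-identityʳ m)))

bit-digit : ∀ {m b} → b ≤ 1 → + (m * b) ≡ + 0 ⊎ + (m * b) ≡ + m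
bit-digit {m} b≤1 with n≤1⇒n≡0∨n≡1 b≤1
... | inj₁ refl = inj₁ (cong +_ (*-zeroʳ m))
... | inj₂ refl = inj₂ (cong +_ (*-identityʳ m))

cycle-bits : ∀ {g m r} (x l : Fin r → ℤ) → IsExtremeCycle g m r x l →
             ∃[ k ] (∀ j → k j ≤ 1) × (∀ j → + g ℤ.* x (next j) ≡ x j ℤ.+ + (m * k j))
cycle-bits x l (_ , _ , digits , step) =
  (λ j → proj₁ (digit-bit (digits j))) ,
  (λ j → proj₁ (proj₂ (digit-bit (digits j)))) ,
  (λ j → trans (step j) (cong (λ v → x j ℤ.+ v) (proj₂ (proj₂ (digit-bit (digits j))))))

complete-below : ∀ {g m} → m < g ∸ 1 → Complete g m
complete-below {suc (suc h)} {m} m<g∸1 (suc r) x l cycle j =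
  trans (cong x (sym (wrap-toℕ j))) (vanishes (cycle-value {m = m} (s≤s (s≤s z≤n)) x k bit-step (toℕ j)))
  where
  g : ℕ
  g = suc (suc h)
  k : Fin (suc r) → ℕ
  k = proj₁ (cycle-bits {g} {m} x l cycle)
  bits : ∀ j → k j ≤ 1
  bits = proj₁ (proj₂ (cycle-bits {g} {m} x l cycle))
  bit-step : ∀ j → + g ℤ.* x (next j) ≡ x j ℤ.+ + (m * k j)
  bit-step = proj₂ (proj₂ (cycle-bits {g} {m} x l cycle))
  0<N : 0 < g ^ suc r ∸ 1
  0<N = m<n⇒0<n∸m (^-monoʳ-< g (s≤s (s≤s z≤n)) {0} {suc r} (s≤s z≤n))
  R≤N : suc h * rotatedValue g k (toℕ j) ≤ g ^ suc r ∸ 1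
  R≤N = m+n≤o⇒m≤o∸n _ (baseValue-bits-bound (suc h) (suc r) _ (λ i → bits (wrap (toℕ j + i))))
  vanishes : ∀ {y} → ∃[ a ] y ≡ + a × m * rotatedValue g k (toℕ j) ≡ (g ^ suc r ∸ 1) * a → y ≡ + 0
  vanishes (a , y≡a , mR≡Na) = trans y≡a (cong +_ (m*S≡N*a⇒a≡0 m<g∸1 0<N R≤N mR≡Na))

-- Orbits in ℕ

least-witness : ∀ {ℓ} {P : ℕ → Set ℓ} → Decidable P → ∀ {n} → P n → ∃[ p ] P p × (∀ q → q < p → ¬ P q)
least-witness {P = P} P? {n} Pn = search 0 n (λ _ ()) Pn
  where
  search : ∀ b fuel → (∀ q → q < b → ¬ P q) → P (b + fuel) → ∃[ p ] P p × (∀ q → q < p → ¬ P q)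
  search b zero        none-below P[b+0] = b , subst P (+-identityʳ b) P[b+0] , none-below
  search b (suc fuel)  none-below P[b+1+fuel] with P? b
  ... | yes Pb  = b , Pb , none-below
  ... | no  ¬Pb = search (suc b) fuel none-upto-b (subst P (+-suc b fuel) P[b+1+fuel])
    where
    none-upto-b : ∀ q → q < suc b → ¬ P q
    none-upto-b q q<1+b with m<1+n⇒m<n∨m≡n q<1+b
    ... | inj₁ q<b  = none-below q q<b
    ... | inj₂ refl = ¬Pb

module Orbit (g m : ℕ) (A K : ℕ → ℕ) (step : ∀ t → g * A (suc t) ≡ A t + m * K t) where

  cycle-step : ∀ {p} → A (suc p) ≡ A 0 → ∀ (j : Fin (suc p)) →
               + g ℤ.* + A (toℕ (next j)) ≡ + A (toℕ j) ℤ.+ + (m * K (toℕ j))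
  cycle-step closed j = begin
    + g ℤ.* + A (toℕ (next j))         ≡⟨ cong (λ v → + g ℤ.* + v) (toℕ-next-closed A closed j) ⟩
    + g ℤ.* + A (suc (toℕ j))          ≡⟨ ℤ.pos-* g _ ⟨
    + (g * A (suc (toℕ j)))            ≡⟨ cong +_ (step (toℕ j)) ⟩
    + (A (toℕ j) + m * K (toℕ j))      ≡⟨ ℤ.pos-+ (A (toℕ j)) _ ⟩
    + A (toℕ j) ℤ.+ + (m * K (toℕ j))  ∎
    where open ≡-Reasoning

  module _ .{{_ : NonZero g}} (bits : ∀ t → K t ≤ 1) (g∤m : ¬ g ∣ m) where

    g∣A+mK : ∀ t → g ∣ A t + m * K t
    g∣A+mK t = divides (A (suc t)) (trans (sym (step t)) (*-comm g _))

    differing-digits⇒g∣m : ∀ {a b} → A a ≡ A b → K a ≡ 0 → K b ≡ 1 → g ∣ m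
    differing-digits⇒g∣m {a} {b} Aa≡Ab Ka≡0 Kb≡1 = ∣m+n∣m⇒∣n g∣A+m g∣A
      where
      g∣A : g ∣ A a
      g∣A = subst (g ∣_) (trans (cong (λ v → A a + m * v) Ka≡0) (trans (cong (λ v → A a + v) (*-zeroʳ m)) (+-identityʳ (A a))))
                  (g∣A+mK a)
      g∣A+m : g ∣ A a + m
      g∣A+m = subst (g ∣_) (cong₂ _+_ (sym Aa≡Ab) (trans (cong (m *_) Kb≡1) (*-identityʳ m))) (g∣A+mK b)

    digit-determined : ∀ {a b} → A a ≡ A b → K a ≡ K b
    digit-determined {a} {b} Aa≡Ab with n≤1⇒n≡0∨n≡1 (bits a) | n≤1⇒n≡0∨n≡1 (bits b)
    ... | inj₁ Ka≡0 | inj₁ Kb≡0 = trans Ka≡0 (sym Kb≡0)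
    ... | inj₂ Ka≡1 | inj₂ Kb≡1 = trans Ka≡1 (sym Kb≡1)
    ... | inj₁ Ka≡0 | inj₂ Kb≡1 = ⊥-elim (g∤m (differing-digits⇒g∣m Aa≡Ab Ka≡0 Kb≡1))
    ... | inj₂ Ka≡1 | inj₁ Kb≡0 = ⊥-elim (g∤m (differing-digits⇒g∣m (sym Aa≡Ab) Kb≡0 Ka≡1))

    orbit-determined : ∀ {a b} → A a ≡ A b → ∀ c → A (a + c) ≡ A (b + c)
    orbit-determined {a} {b} Aa≡Ab zero = trans (cong A (+-identityʳ a)) (trans Aa≡Ab (cong A (sym (+-identityʳ b))))
    orbit-determined {a} {b} Aa≡Ab (suc c) = begin
      A (a + suc c)  ≡⟨ cong A (+-suc a c) ⟩
      A (suc (a + c)) ≡⟨ *-cancelˡ-≡ _ _ g (begin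
        g * A (suc (a + c))          ≡⟨ step (a + c) ⟩
        A (a + c) + m * K (a + c)    ≡⟨ cong₂ (λ u v → u + m * v) Aac≡Abc (digit-determined Aac≡Abc) ⟩
        A (b + c) + m * K (b + c)    ≡⟨ step (b + c) ⟨
        g * A (suc (b + c))          ∎) ⟩
      A (suc (b + c)) ≡⟨ cong A (+-suc b c) ⟨
      A (b + suc c)  ∎
      where
      open ≡-Reasoning
      Aac≡Abc : A (a + c) ≡ A (b + c)
      Aac≡Abc = orbit-determined Aa≡Ab c

    no-early-return : ∀ {p} → (∀ q → q < p → A (suc q) ≢ A 0) → A (suc p) ≡ A 0 →
                      ∀ {a b} → a < b → b ≤ p → A a ≢ A b
    no-early-return {p} minimal closed {a} {b} a<b b≤p Aa≡Ab with m≤n⇒∃[o]m+o≡n b≤p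
    ... | o , b+o≡p = minimal (a + o) (subst (a + o <_) b+o≡p (+-monoˡ-< o a<b)) (begin
      A (suc (a + o))  ≡⟨ cong A (+-suc a o) ⟨
      A (a + suc o)    ≡⟨ orbit-determined Aa≡Ab (suc o) ⟩
      A (b + suc o)    ≡⟨ cong A (trans (+-suc b o) (cong suc b+o≡p)) ⟩
      A (suc p)        ≡⟨ closed ⟩
      A 0              ∎)
      where open ≡-Reasoning

    -- Up to its first return the orbit is injective (by minimality and orbit-determined), hence an extreme cycle.
    incomplete : ∀ {n} → A (suc n) ≡ A 0 → A 0 ≢ 0 → Incomplete g m
    incomplete returns A0≢0 complete with least-witness (λ q → A (suc q) ≟ A 0) returns
    ... | p , closed , minimal =
      A0≢0 (ℤ.+-injective (complete (suc p) y l (s≤s z≤n , y-injective , digits , cycle-step closed) Fzero))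
      where
      y : Fin (suc p) → ℤ
      y i = + A (toℕ i)
      l : Fin (suc p) → ℤ
      l i = + (m * K (toℕ i))
      y-injective : Injective _≡_ _≡_ y
      y-injective {i} {j} yi≡yj with <-cmp (toℕ i) (toℕ j)
      ... | tri< i<j _ _ = ⊥-elim (no-early-return minimal closed i<j (≤-pred (toℕ<n j)) (ℤ.+-injective yi≡yj))
      ... | tri≈ _ i≡j _ = toℕ-injective i≡j
      ... | tri> _ _ j<i = ⊥-elim (no-early-return minimal closed j<i (≤-pred (toℕ<n i)) (sym (ℤ.+-injective yi≡yj)))
      digits : ∀ j → l j ≡ + 0 ⊎ l j ≡ + m
      digits j = bit-digit (bits (toℕ j))

-- The values R t of the rotated digit strings satisfy g R (t+1) = R t + (g^n - 1) k_t; as d is prime to g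
-- it divides every R t, and A = R / d is an orbit for the digit set {0, m} returning after n steps.
incomplete-from-digits :
  ∀ {g} → 1 < g → (n : ℕ) → 1 ≤ n → (k : Fin n → ℕ) → (∀ i → k i ≤ 1) → ¬ (∀ i → k i ≡ 0) →
  (m : ℕ) → m * gcd (digitSum g n k) (g ^ n ∸ 1) ≡ g ^ n ∸ 1 →
  Incomplete g m × Σ (Fin n → ℤ) (λ x → ¬ (∀ j → x j ≡ + 0) × (∀ j → + g ℤ.* x (next j) ≡ x j ℤ.+ + (m * k j)))
incomplete-from-digits 1<g zero ()
incomplete-from-digits {g} 1<g (suc n) _ k bits not-all-zero m md≡N =
  Orbit.incomplete g m A K A-step (λ t → bits (wrap t)) g∤m A-returns A₀≢0 , x , x≢0 , x-step
  where
  instance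
    g≢0 : NonZero g
    g≢0 = >-nonZero (<-trans z<s 1<g)
  S₀ : ℕ
  S₀ = digitSum g (suc n) k
  N : ℕ
  N = g ^ suc n ∸ 1
  d : ℕ
  d = gcd S₀ N
  R : ℕ → ℕ
  R = rotatedValue g k
  K : ℕ → ℕ
  K t = k (wrap t)
  instance
    d≢0 : NonZero d
    d≢0 = ≢-nonZero (gcd[m,n]≢0 S₀ N (inj₂ (pow∸1≢0 1<g n)))
  R-step : ∀ t → g * R (suc t) ≡ R t + d * (m * K t)
  R-step t = +-cancelʳ-≡ (K t) _ _ (begin
    g * R (suc t) + K t            ≡⟨ rotatedValue-step g k t ⟩
    R t + g ^ suc n * K t          ≡⟨ cong (λ v → R t + v * K t) (sym (m∸n+n≡m (m^n>0 g (suc n)))) ⟩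
    R t + (N + 1) * K t            ≡⟨ cong (λ v → R t + (v + 1) * K t) md≡N ⟨
    R t + (m * d + 1) * K t        ≡⟨ rearrange (R t) m d (K t) ⟩
    R t + d * (m * K t) + K t      ∎)
    where
    open ≡-Reasoning
    rearrange : ∀ r m d κ → r + (m * d + 1) * κ ≡ r + d * (m * κ) + κ
    rearrange = solve-∀
  d∣R : ∀ t → d ∣ R t
  d∣R = ∣-along-orbit (λ (c∣d , c∣g) → coprime-pow∸1 g n (c∣g , ∣-trans c∣d (gcd[m,n]∣n S₀ N)))
                     (subst (d ∣_) (sym (rotatedValue-0 g k)) (gcd[m,n]∣m S₀ N)) R-step
  A : ℕ → ℕ
  A t = R t / d
  A-step : ∀ t → g * A (suc t) ≡ A t + m * K t
  A-step t = *-cancelʳ-≡ _ _ d (begin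
    g * A (suc t) * d              ≡⟨ *-assoc g (A (suc t)) d ⟩
    g * (A (suc t) * d)            ≡⟨ cong (g *_) (m/n*n≡m (d∣R (suc t))) ⟩
    g * R (suc t)                  ≡⟨ R-step t ⟩
    R t + d * (m * K t)            ≡⟨ cong (λ v → v + d * (m * K t)) (m/n*n≡m (d∣R t)) ⟨
    A t * d + d * (m * K t)        ≡⟨ rearrange (A t) d (m * K t) ⟩
    (A t + m * K t) * d            ∎)
    where
    open ≡-Reasoning
    rearrange : ∀ a d e → a * d + d * e ≡ (a + e) * d
    rearrange = solve-∀
  g∤m : ¬ g ∣ m
  g∤m g∣m = <-irrefl (sym (coprime-pow∸1 g n (∣-refl , subst (g ∣_) md≡N (∣m⇒∣m*n d g∣m)))) 1<g
  A-returns : A (suc n) ≡ A 0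
  A-returns = cong (_/ d) (rotatedValue-periodic g k)
  A₀≢0 : A 0 ≢ 0
  A₀≢0 A₀≡0 = not-all-zero (digitSum≡0⇒zeros g (suc n) k (begin
    digitSum g (suc n) k   ≡⟨ rotatedValue-0 g k ⟨
    R 0                    ≡⟨ m/n*n≡m (d∣R 0) ⟨
    A 0 * d                ≡⟨ cong (_* d) A₀≡0 ⟩
    0                      ∎))
    where open ≡-Reasoning
  x : Fin (suc n) → ℤ
  x j = + A (toℕ j)
  x≢0 : ¬ (∀ j → x j ≡ + 0)
  x≢0 all-zero = A₀≢0 (ℤ.+-injective (all-zero Fzero))
  x-step : ∀ j → + g ℤ.* x (next j) ≡ x j ℤ.+ + (m * k j)
  x-step j = trans (Orbit.cycle-step g m A K A-step A-returns j) (cong (λ i → x j ℤ.+ + (m * k i)) (wrap-toℕ j))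

primitive-minimal : ∀ {g m e} → Primitive g m → e ∣ m → Incomplete g e → e ≡ m
primitive-minimal {m = m} {e} (_ , _ , proper-divisors-complete) e∣m e-incomplete with e ≟ m
... | yes e≡m = e≡m
... | no  e≢m = ⊥-elim (e-incomplete (proper-divisors-complete e e∣m e≢m))

-- For n = 0 the order hypothesis gives m ∣ g - 1, so m < g - 1 would be complete; for n > 0 a
-- cycle with only zero digits is the trivial one, which is not injective.
cycle-digits≢0 : ∀ {g m} n → 1 < g → Primitive g m → m ≢ g ∸ 1 → IsOrder g m (suc n) →
                 (x l : Fin (suc n) → ℤ) → IsExtremeCycle g m (suc n) x l → ¬ (∀ j → l j ≡ + 0)
cycle-digits≢0 {g} {m} zero 1<g (_ , m-incomplete , _) m≢g∸1 (_ , m∣g^1∸1 , _) _ _ _ _ =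
  m-incomplete (complete-below {g} (≤∧≢⇒< (∣⇒≤ m∣g∸1) m≢g∸1))
  where
  instance
    g∸1≢0 : NonZero (g ∸ 1)
    g∸1≢0 = >-nonZero (m<n⇒0<n∸m 1<g)
  m∣g∸1 : m ∣ g ∸ 1
  m∣g∸1 = subst (λ v → m ∣ v ∸ 1) (*-identityʳ g) m∣g^1∸1
cycle-digits≢0 {g} (suc n) 1<g _ _ _ x l (_ , injective , _ , step) l≡0 =
  Fzero≢Fsuc (injective (trans (x≡0 Fzero) (sym (x≡0 (Fsuc Fzero)))))
  where
  x≡0 : ∀ j → x j ≡ + 0
  x≡0 = complete-below {g} {0} (m<n⇒0<n∸m 1<g) (suc (suc n)) x l (s≤s z≤n , injective , (λ j → inj₁ (l≡0 j)) , step)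

primitive-cycle-gcd :
  ∀ {g} → 1 < g → (m n : ℕ) → Primitive g m → m ≢ g ∸ 1 → IsOrder g m n →
  (x l : Fin n → ℤ) → IsExtremeCycle g m n x l →
  (k : Fin n → ℕ) → (∀ i → k i ≤ 1) → (∀ i → l i ≡ + (m * k i)) →
  m * gcd (digitSum g n k) (g ^ n ∸ 1) ≡ g ^ n ∸ 1
primitive-cycle-gcd 1<g m zero _ _ (() , _)
primitive-cycle-gcd {g} 1<g m (suc n) prim m≢g∸1 order x l cycle@(_ , _ , _ , step) k bits l≡mk =
  subst (λ e → e * d ≡ N) m′≡m m′d≡N
  where
  S₀ : ℕ
  S₀ = digitSum g (suc n) k
  N : ℕ
  N = g ^ suc n ∸ 1
  d : ℕ
  d = gcd S₀ N
  instance
    d≢0 : NonZero d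
    d≢0 = ≢-nonZero (gcd[m,n]≢0 S₀ N (inj₂ (pow∸1≢0 1<g n)))
  m′ : ℕ
  m′ = N / d
  m′d≡N : m′ * d ≡ N
  m′d≡N = m/n*n≡m (gcd[m,n]∣n S₀ N)
  k≢0 : ¬ (∀ i → k i ≡ 0)
  k≢0 k≡0 = cycle-digits≢0 n 1<g prim m≢g∸1 order x l cycle
              (λ j → trans (l≡mk j) (cong +_ (trans (cong (m *_) (k≡0 j)) (*-zeroʳ m))))
  bit-step : ∀ j → + g ℤ.* x (next j) ≡ x j ℤ.+ + (m * k j)
  bit-step j = trans (step j) (cong (λ v → x j ℤ.+ v) (l≡mk j))
  N∣mS₀ : N ∣ m * S₀
  N∣mS₀ = let (a , _ , mR≡Na) = cycle-value {m = m} 1<g x k bit-step 0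
          in divides a (trans (cong (m *_) (sym (rotatedValue-0 g k))) (trans mR≡Na (*-comm N a)))
  m′≡m : m′ ≡ m
  m′≡m = primitive-minimal {g} prim (∣m*s⇒N/gcd∣m N∣mS₀) (proj₁ (incomplete-from-digits 1<g (suc n) (s≤s z≤n) k bits k≢0 m′ m′d≡N))

theorem4p9 : (g : ℕ) → Even g → 4 ≤ g →
    ((m n : ℕ) → Primitive g m → m ≢ g ∸ 1 → IsOrder g m n →
      (x l : Fin n → ℤ) → IsExtremeCycle g m n x l →
      (k : Fin n → ℕ) → (∀ i → k i ≤ 1) → (∀ i → l i ≡ + (m * k i)) →
      m * gcd (digitSum g n k) (g ^ n ∸ 1) ≡ g ^ n ∸ 1)
    ×
    ((n : ℕ) → 1 ≤ n → (k : Fin n → ℕ) → (∀ i → k i ≤ 1) → ¬ (∀ i → k i ≡ 0) →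
      (m : ℕ) → m * gcd (digitSum g n k) (g ^ n ∸ 1) ≡ g ^ n ∸ 1 →
      Incomplete g m
      × Σ (Fin n → ℤ) (λ x → ¬ (∀ j → x j ≡ + 0)
          × (∀ j → + g ℤ.* x (next j) ≡ x j ℤ.+ + (m * k j))))
theorem4p9 g _ 4≤g = primitive-cycle-gcd 1<g , incomplete-from-digits 1<g
  where
  1<g : 1 < g
  1<g = ≤-trans (s≤s (s≤s z≤n)) 4≤g
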